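{- Let $k$ and $N$ be odd positive integers with $N\le k/3$. Then there exists a minion homomorphism $\eta\colon\mathcal Z_{\le N}\to\mathrm{Pol}(\mathbf C_k,\mathbf C_3)$.
   Context: $\mathbf C_m$ is the $m$-cycle on $\{0,\dots,m-1\}$, vertices adjacent iff they differ by $1$ mod $m$. The direct power $\mathbf C_k^n$ has vertex set $V(C_k)^n$, $(\bar u,\bar v)$ an edge iff $(u_j,v_j)\in E(C_k)$ for all $j$. $\mathrm{Pol}(\mathbf C_k,\mathbf C_3)$ is the set of all graph homomorphisms $\mathbf C_k^n\to\mathbf C_3$, $n\ge1$. For odd $N$, $\mathcal Z_{\le N}$ is the set of all functions $\mathbb Z^n\to\mathbb Z$ ($n\ge1$) of the form $\sum_ic_ix_i$ with $c_i\in\mathbb Z$, $\sum_i|c_i|\le N$ and $\sum_ic_i$ odd. A minor of an $m$-ary $g$ given by $\pi\colon\{1,\dots,m\}\to\{1,\dots,n\}$ is the $n$-ary function $(x_1,\dots,x_n)\mapsto g(x_{\pi(1)},\dots,x_{\pi(m)})$; a minion is a nonempty set of functions closed under minors; a minion homomorphism is a map preserving arities and sending the minor of $g$ given by $\pi$ to the minor of its image given by $\pi$, for all $g$ and $\pi$. -}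

module Defs where

open import Data.Nat using (ℕ; zero; suc; _%_) renaming (_+_ to _+ℕ_; _*_ to _*ℕ_)
open import Data.Fin using (Fin; toℕ) renaming (zero to fzero; suc to fsuc)
open import Data.Integer using (ℤ; +_; _+_; _*_; ∣_∣; _≤_)
open import Data.Product using (Σ; ∃; _×_; _,_; proj₁)
open import Data.Sum using (_⊎_)
open import Relation.Binary.PropositionalEquality using (_≡_)

OddNat : ℕ → Set
OddNat k = ∃ λ t → k ≡ suc (2 *ℕ t)

Oddℤ : ℤ → Set
Oddℤ s = ∃ λ t → s ≡ + 1 + (+ 2) * t

sumℤ : ∀ {n} → (Fin n → ℤ) → ℤ
sumℤ {zero}  f = + 0
sumℤ {suc n} f = f fzero + sumℤ (λ i → f (fsuc i))

sumℕ : ∀ {n} → (Fin n → ℕ) → ℕ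
sumℕ {zero}  f = 0
sumℕ {suc n} f = f fzero +ℕ sumℕ (λ i → f (fsuc i))

Adj : (m : ℕ) → Fin m → Fin m → Set
Adj zero    () v
Adj (suc m) u v = (toℕ v ≡ suc (toℕ u) % suc m) ⊎ (toℕ u ≡ suc (toℕ v) % suc m)

Pol : (k n : ℕ) → Set
Pol k n = Σ ((Fin n → Fin k) → Fin 3) λ f →
  ∀ (x y : Fin n → Fin k) → (∀ j → Adj k (x j) (y j)) → Adj 3 (f x) (f y)

Z≤ : (N n : ℕ) → Set
Z≤ N n = Σ ((Fin n → ℤ) → ℤ) λ f →
  ∃ λ (c : Fin n → ℤ) →
    (sumℕ (λ i → ∣ c i ∣) Data.Nat.≤ N) × Oddℤ (sumℤ c) ×
    (∀ x → f x ≡ sumℤ (λ i → c i * x i))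
  where import Data.Nat

-- Elements are functions, compared extensionally. The condition says: whenever
-- h is (extensionally) the minor of g given by π, then η h is the minor of η g
-- given by π. (With π = id this also gives well-definedness on functions.)
record MinionHom (N k : ℕ) : Set where
  field
    η : ∀ {n} → Z≤ N (suc n) → Pol k (suc n)
    η-minor : ∀ {m n} (π : Fin (suc m) → Fin (suc n))
      (g : Z≤ N (suc m)) (h : Z≤ N (suc n)) →
      (∀ x → proj₁ h x ≡ proj₁ g (λ i → x (π i))) →
      ∀ x → proj₁ (η h) x ≡ proj₁ (η g) (λ i → x (π i))

-- Write k = 2t + 1, so that t + 1 is the inverse of 2 modulo k, and colour a residue by the third
-- of [0, k) containing it. The linear form f is sent to x ↦ colour of (t + 1)·f(x). If x and y are
-- adjacent in C_k^n then y ≡ x + ε (mod k) with every ε_i = ±1, so f(y) ≡ f(x) + e where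
-- e = Σ c_i ε_i is odd (as Σ c_i is) and |e| ≤ N ≤ k/3. For e = ±(2n + 1) the image moves by
-- ±(t + 1 + n) modulo k, and k/3 ≤ t + 1 + n ≤ 2k/3, so the two residues land in different thirds;
-- distinct vertices of C_3 are adjacent. Minors are preserved since the construction is a
-- postcomposition.

module Submission where

open import Data.Fin using (Fin; toℕ; fromℕ<) renaming (zero to fzero; suc to fsuc)
open import Data.Fin.Patterns using (0F; 1F; 2F)
open import Data.Fin.Properties using (toℕ<n; toℕ-fromℕ<)
open import Data.Integer
open import Data.Integer.DivMod using (n%ℕd<d; a≡a%ℕn+[a/ℕn]*n)
open import Data.Integer.Properties
open import Algebra.Properties.Semiring.Sum +-*-semiring
  using (sum; sum-cong-≗; ∑-distrib-+; *-distribˡ-sum)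
open import Data.Integer.Tactic.RingSolver using (solve-∀; solve)
open import Data.List using ([]; _∷_)
open import Data.Nat as ℕ using (ℕ)
import Data.Nat.DivMod as ℕ
import Data.Nat.Properties as ℕ
import Data.Nat.Tactic.RingSolver as ℕ
open import Data.Product using (∃; _×_; _,_; proj₁; proj₂)
open import Data.Sum using (_⊎_; inj₁; inj₂)
open import Relation.Binary.PropositionalEquality
open import Relation.Nullary using (contradiction)
open import Function using (_∘_)

open import Defs

m/n≡o/n⇒o<m+n : ∀ m n o .{{_ : ℕ.NonZero n}} → m ℕ./ n ≡ o ℕ./ n → o ℕ.< m ℕ.+ n
m/n≡o/n⇒o<m+n m n o eq = begin-strict
  o                         ≡⟨ ℕ.m≡m%n+[m/n]*n o n ⟩
  o ℕ.% n ℕ.+ o ℕ./ n ℕ.* n <⟨ ℕ.+-monoˡ-< (o ℕ./ n ℕ.* n) (ℕ.m%n<n o n) ⟩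
  n ℕ.+ o ℕ./ n ℕ.* n       ≡⟨ cong (λ q → n ℕ.+ q ℕ.* n) eq ⟨
  n ℕ.+ m ℕ./ n ℕ.* n       ≤⟨ ℕ.+-monoʳ-≤ n (ℕ.m/n*n≤m m n) ⟩
  n ℕ.+ m                   ≡⟨ ℕ.+-comm n m ⟩
  m ℕ.+ n                   ∎
  where open ℕ.≤-Reasoning

shift-forward-far : ∀ k d M M' w → k ℕ.≤ 3 ℕ.* d → M' ≡ M ℕ.+ d ℕ.+ k ℕ.* w →
                    3 ℕ.* M ℕ.+ k ℕ.≤ 3 ℕ.* M'
shift-forward-far k d M _ w k≤3d refl = begin
  3 ℕ.* M ℕ.+ k                           ≤⟨ ℕ.+-monoʳ-≤ (3 ℕ.* M) k≤3d ⟩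
  3 ℕ.* M ℕ.+ 3 ℕ.* d                     ≤⟨ ℕ.m≤m+n _ (3 ℕ.* (k ℕ.* w)) ⟩
  3 ℕ.* M ℕ.+ 3 ℕ.* d ℕ.+ 3 ℕ.* (k ℕ.* w) ≡⟨ ℕ.solve (M ∷ d ∷ k ∷ w ∷ []) ⟩
  3 ℕ.* (M ℕ.+ d ℕ.+ k ℕ.* w)             ∎
  where open ℕ.≤-Reasoning

shift-backward-far : ∀ k d M M' w → 3 ℕ.* d ℕ.≤ 2 ℕ.* k →
                     M' ℕ.+ k ℕ.* ℕ.suc w ≡ M ℕ.+ d →
                     3 ℕ.* M' ℕ.+ k ℕ.≤ 3 ℕ.* M
shift-backward-far k d M M' w 3d≤2k eq = ℕ.+-cancelʳ-≤ (2 ℕ.* k) _ _ (begin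
  3 ℕ.* M' ℕ.+ k ℕ.+ 2 ℕ.* k   ≡⟨ ℕ.solve (M' ∷ k ∷ []) ⟩
  3 ℕ.* (M' ℕ.+ k)             ≤⟨ ℕ.*-monoʳ-≤ 3 (ℕ.+-monoʳ-≤ M' (ℕ.m≤m*n k (ℕ.suc w))) ⟩
  3 ℕ.* (M' ℕ.+ k ℕ.* ℕ.suc w) ≡⟨ cong (3 ℕ.*_) eq ⟩
  3 ℕ.* (M ℕ.+ d)              ≡⟨ ℕ.*-distribˡ-+ 3 M d ⟩
  3 ℕ.* M ℕ.+ 3 ℕ.* d          ≤⟨ ℕ.+-monoʳ-≤ (3 ℕ.* M) 3d≤2k ⟩
  3 ℕ.* M ℕ.+ 2 ℕ.* k          ∎)
  where open ℕ.≤-Reasoning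

half-odd-in-middle-third : ∀ t n → 3 ℕ.* ℕ.suc (2 ℕ.* n) ℕ.≤ ℕ.suc (2 ℕ.* t) →
                           ℕ.suc (2 ℕ.* t) ℕ.≤ 3 ℕ.* ℕ.suc (t ℕ.+ n) ×
                           3 ℕ.* ℕ.suc (t ℕ.+ n) ℕ.≤ 2 ℕ.* ℕ.suc (2 ℕ.* t)
half-odd-in-middle-third t n h = lower , ℕ.*-cancelˡ-≤ 2 upper
  where
  open ℕ.≤-Reasoning
  lower : ℕ.suc (2 ℕ.* t) ℕ.≤ 3 ℕ.* ℕ.suc (t ℕ.+ n)
  lower = begin
    ℕ.suc (2 ℕ.* t)                            ≤⟨ ℕ.m≤m+n _ (2 ℕ.+ t ℕ.+ 3 ℕ.* n) ⟩
    ℕ.suc (2 ℕ.* t) ℕ.+ (2 ℕ.+ t ℕ.+ 3 ℕ.* n) ≡⟨ ℕ.solve (t ∷ n ∷ []) ⟩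
    3 ℕ.* ℕ.suc (t ℕ.+ n)                      ∎
  upper : 2 ℕ.* (3 ℕ.* ℕ.suc (t ℕ.+ n)) ℕ.≤ 2 ℕ.* (2 ℕ.* ℕ.suc (2 ℕ.* t))
  upper = begin
    2 ℕ.* (3 ℕ.* ℕ.suc (t ℕ.+ n))           ≡⟨ ℕ.solve (t ∷ n ∷ []) ⟩
    3 ℕ.* ℕ.suc (2 ℕ.* n) ℕ.+ (3 ℕ.+ 6 ℕ.* t) ≤⟨ ℕ.+-monoˡ-≤ (3 ℕ.+ 6 ℕ.* t) h ⟩
    ℕ.suc (2 ℕ.* t) ℕ.+ (3 ℕ.+ 6 ℕ.* t)     ≡⟨ ℕ.solve (t ∷ []) ⟩
    2 ℕ.* (2 ℕ.* ℕ.suc (2 ℕ.* t))           ∎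

shifted-residues-far : ∀ k d M M' w → k ℕ.≤ 3 ℕ.* d → 3 ℕ.* d ℕ.≤ 2 ℕ.* k →
                       + M' ≡ + M + + d + + k * w →
                       3 ℕ.* M ℕ.+ k ℕ.≤ 3 ℕ.* M' ⊎ 3 ℕ.* M' ℕ.+ k ℕ.≤ 3 ℕ.* M
shifted-residues-far k d M M' (+ n) k≤3d _ e = inj₁ (shift-forward-far k d M M' n k≤3d
  (+-injective (trans e (cong (λ x → + M + + d + x) (sym (pos-* k n))))))
shifted-residues-far k d M M' -[1+ n ] _ 3d≤2k e = inj₂ (shift-backward-far k d M M' n 3d≤2k
  (+-injective (begin
    + M' + + (k ℕ.* ℕ.suc n)                        ≡⟨ cong₂ _+_ e (pos-* k (ℕ.suc n)) ⟩
    + M + + d + + k * - + ℕ.suc n + + k * + ℕ.suc n ≡⟨ cancel (+ M + + d) (+ k) (+ ℕ.suc n) ⟩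
    + M + + d                                       ∎)))
  where
  open ≡-Reasoning
  cancel : ∀ a b c → a + b * - c + b * c ≡ a
  cancel = solve-∀

residues-differ-by : ∀ k .{{_ : ℕ.NonZero k}} A A' D W → A' ≡ A + D + + k * W →
                     ∃ λ w → + (A' %ℕ k) ≡ + (A %ℕ k) + D + + k * w
residues-differ-by k A A' D W eq = W + A /ℕ k - A' /ℕ k ,
  solve-for-remainder (+ (A' %ℕ k)) (A' /ℕ k) (+ (A %ℕ k)) (A /ℕ k) D W (+ k) (begin
    + (A' %ℕ k) + A' /ℕ k * + k ≡⟨ a≡a%ℕn+[a/ℕn]*n A' k ⟨
    A'                          ≡⟨ eq ⟩
    A + D + + k * W             ≡⟨ cong (λ a → a + D + + k * W) (a≡a%ℕn+[a/ℕn]*n A k) ⟩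
    + (A %ℕ k) + A /ℕ k * + k + D + + k * W ∎)
  where
  open ≡-Reasoning
  solve-for-remainder : ∀ m' q' m q d w k → m' + q' * k ≡ m + q * k + d + k * w →
                        m' ≡ m + d + k * (w + q - q')
  solve-for-remainder m' q' m q d w k e = begin
    m'                                ≡⟨ solve (m' ∷ q' ∷ k ∷ []) ⟩
    m' + q' * k - q' * k              ≡⟨ cong (_- q' * k) e ⟩
    m + q * k + d + k * w - q' * k    ≡⟨ solve (m ∷ q ∷ k ∷ d ∷ w ∷ q' ∷ []) ⟩
    m + d + k * (w + q - q')          ∎

odd-times-half : ∀ t n →
                 + ℕ.suc (2 ℕ.* n) * + ℕ.suc t ≡ + ℕ.suc (t ℕ.+ n) + + ℕ.suc (2 ℕ.* t) * + n
odd-times-half t n = begin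
  + ℕ.suc (2 ℕ.* n) * + ℕ.suc t                   ≡⟨ pos-* (ℕ.suc (2 ℕ.* n)) (ℕ.suc t) ⟨
  + (ℕ.suc (2 ℕ.* n) ℕ.* ℕ.suc t)                 ≡⟨ cong +_ (ℕ.solve (t ∷ n ∷ [])) ⟩
  + ℕ.suc (t ℕ.+ n) + + (ℕ.suc (2 ℕ.* t) ℕ.* n)
    ≡⟨ cong (λ x → + ℕ.suc (t ℕ.+ n) + x) (pos-* (ℕ.suc (2 ℕ.* t)) n) ⟩
  + ℕ.suc (t ℕ.+ n) + + ℕ.suc (2 ℕ.* t) * + n     ∎
  where open ≡-Reasoning

odd⇒±2n+1 : ∀ e → Oddℤ e → ∃ λ n → e ≡ + ℕ.suc (2 ℕ.* n) ⊎ e ≡ - + ℕ.suc (2 ℕ.* n)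
odd⇒±2n+1 e (+ n , refl) = n , inj₁ (cong (λ x → + 1 + x) (sym (pos-* 2 n)))
odd⇒±2n+1 e (-[1+ n ] , refl) = n , inj₂ (trans (negate (+ n))
  (cong (λ x → - (+ 1 + x)) (sym (pos-* 2 n))))
  where
  negate : ∀ x → + 1 + + 2 * - (+ 1 + x) ≡ - (+ 1 + + 2 * x)
  negate = solve-∀

arc : (k : ℕ) .{{_ : ℕ.NonZero k}} → ℤ → Fin 3
arc k A = fromℕ< (ℕ.m<n*o⇒m/o<n (ℕ.*-monoʳ-< 3 (n%ℕd<d A k)))

arc-≡⇒close : ∀ k .{{_ : ℕ.NonZero k}} A A' → arc k A ≡ arc k A' →
              3 ℕ.* (A' %ℕ k) ℕ.< 3 ℕ.* (A %ℕ k) ℕ.+ k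
arc-≡⇒close k A A' eq = m/n≡o/n⇒o<m+n (3 ℕ.* (A %ℕ k)) k (3 ℕ.* (A' %ℕ k))
  (trans (sym (toℕ-fromℕ< _)) (trans (cong toℕ eq) (toℕ-fromℕ< _)))

arc-shift : ∀ k .{{_ : ℕ.NonZero k}} {d} A A' W → k ℕ.≤ 3 ℕ.* d → 3 ℕ.* d ℕ.≤ 2 ℕ.* k →
            A' ≡ A + + d + + k * W → arc k A ≢ arc k A'
arc-shift k {d} A A' W k≤3d 3d≤2k eq same
  with residues-differ-by k A A' (+ d) W eq
... | w , e with shifted-residues-far k d (A %ℕ k) (A' %ℕ k) w k≤3d 3d≤2k e
...   | inj₁ far = ℕ.<⇒≱ (arc-≡⇒close k A A' same) far
...   | inj₂ far = ℕ.<⇒≱ (arc-≡⇒close k A' A (sym same)) far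

arc-half-odd-shift : ∀ t n A A' W → 3 ℕ.* ℕ.suc (2 ℕ.* n) ℕ.≤ ℕ.suc (2 ℕ.* t) →
                     A' ≡ A + + ℕ.suc (2 ℕ.* n) * + ℕ.suc t + + ℕ.suc (2 ℕ.* t) * W →
                     arc (ℕ.suc (2 ℕ.* t)) A ≢ arc (ℕ.suc (2 ℕ.* t)) A'
arc-half-odd-shift t n A A' W h eq =
  arc-shift (ℕ.suc (2 ℕ.* t)) A A' (+ n + W)
    (proj₁ (half-odd-in-middle-third t n h)) (proj₂ (half-odd-in-middle-third t n h)) (trans eq (begin
    A + + ℕ.suc (2 ℕ.* n) * + ℕ.suc t + k * W ≡⟨ cong (λ x → A + x + k * W) (odd-times-half t n) ⟩
    A + (d + k * + n) + k * W                 ≡⟨ regroup A d k (+ n) W ⟩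
    A + d + k * (+ n + W)                     ∎))
  where
  open ≡-Reasoning
  k d : ℤ
  k = + ℕ.suc (2 ℕ.* t)
  d = + ℕ.suc (t ℕ.+ n)
  regroup : ∀ a d k n w → a + (d + k * n) + k * w ≡ a + d + k * (n + w)
  regroup = solve-∀

arc-odd-shift : ∀ t e A A' W → Oddℤ e → 3 ℕ.* ∣ e ∣ ℕ.≤ ℕ.suc (2 ℕ.* t) →
                A' ≡ A + e * + ℕ.suc t + + ℕ.suc (2 ℕ.* t) * W →
                arc (ℕ.suc (2 ℕ.* t)) A ≢ arc (ℕ.suc (2 ℕ.* t)) A'
arc-odd-shift t e A A' W odd h eq with odd⇒±2n+1 e odd
... | n , inj₁ refl = arc-half-odd-shift t n A A' W h eq
... | n , inj₂ refl = ≢-sym (arc-half-odd-shift t n A' A (- W) h (begin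
  A                                   ≡⟨ undo A s T k W ⟩
  A + - s * T + k * W + s * T + k * - W ≡⟨ cong (λ x → x + s * T + k * - W) eq ⟨
  A' + s * T + k * - W                ∎))
  where
  open ≡-Reasoning
  s T k : ℤ
  s = + ℕ.suc (2 ℕ.* n)
  T = + ℕ.suc t
  k = + ℕ.suc (2 ℕ.* t)
  undo : ∀ a s T k w → a ≡ a + - s * T + k * w + s * T + k * - w
  undo = solve-∀

Unit : ℤ → Set
Unit ε = ε ≡ 1ℤ ⊎ ε ≡ -1ℤ

toℤ : ∀ {k} → Fin k → ℤ
toℤ u = + toℕ u

suc-mod-step : ∀ K a → a ℕ.< ℕ.suc K →
               ∃ λ m → + (ℕ.suc a ℕ.% ℕ.suc K) ≡ + a + 1ℤ + + ℕ.suc K * m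
suc-mod-step K a a<k with ℕ.m≤n⇒m<n∨m≡n a<k
... | inj₁ 1+a<k = 0ℤ , trans (cong +_ (ℕ.m<n⇒m%n≡m 1+a<k)) (no-wrap (+ a) (+ ℕ.suc K))
  where
  no-wrap : ∀ x k → 1ℤ + x ≡ x + 1ℤ + k * 0ℤ
  no-wrap = solve-∀
... | inj₂ refl = -1ℤ , trans (cong +_ (ℕ.n%n≡0 (ℕ.suc a))) (wrap (+ a))
  where
  wrap : ∀ x → 0ℤ ≡ x + 1ℤ + (1ℤ + x) * -1ℤ
  wrap = solve-∀

adjacent-step : ∀ K (u v : Fin (ℕ.suc K)) → Adj (ℕ.suc K) u v →
                ∃ λ ε → Unit ε × ∃ λ m → toℤ v ≡ toℤ u + ε + + ℕ.suc K * m
adjacent-step K u v (inj₁ v≡1+u) with suc-mod-step K (toℕ u) (toℕ<n u)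
... | m , e = 1ℤ , inj₁ refl , m , trans (cong +_ v≡1+u) e
adjacent-step K u v (inj₂ u≡1+v) with suc-mod-step K (toℕ v) (toℕ<n v)
... | m , e = -1ℤ , inj₂ refl , - m , (begin
  toℤ v                                     ≡⟨ back (toℤ v) k m ⟩
  toℤ v + 1ℤ + k * m + -1ℤ + k * - m         ≡⟨ cong (λ x → x + -1ℤ + k * - m) (trans (cong +_ u≡1+v) e) ⟨
  toℤ u + -1ℤ + k * - m                      ∎)
  where
  open ≡-Reasoning
  k : ℤ
  k = + ℕ.suc K
  back : ∀ x k m → x ≡ x + 1ℤ + k * m + -1ℤ + k * - m
  back = solve-∀

sumℤ≡sum : ∀ {n} (f : Fin n → ℤ) → sumℤ f ≡ sum f
sumℤ≡sum {ℕ.zero}  f = refl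
sumℤ≡sum {ℕ.suc n} f = cong (λ s → f fzero + s) (sumℤ≡sum (f ∘ fsuc))

∣sum∣≤sumℕ : ∀ {n} (f : Fin n → ℤ) (g : Fin n → ℕ) → (∀ i → ∣ f i ∣ ℕ.≤ g i) →
             ∣ sum f ∣ ℕ.≤ sumℕ g
∣sum∣≤sumℕ {ℕ.zero}  f g bound = ℕ.z≤n
∣sum∣≤sumℕ {ℕ.suc n} f g bound = ℕ.≤-trans (∣i+j∣≤∣i∣+∣j∣ (f fzero) _)
  (ℕ.+-mono-≤ (bound fzero) (∣sum∣≤sumℕ (f ∘ fsuc) (g ∘ fsuc) (bound ∘ fsuc)))

sum-linear-shift : ∀ {n} (c x ε m : Fin n → ℤ) K →
                   sum (λ i → c i * (x i + ε i + K * m i)) ≡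
                   sum (λ i → c i * x i) + sum (λ i → c i * ε i) + K * sum (λ i → c i * m i)
sum-linear-shift c x ε m K = begin
  sum (λ i → c i * (x i + ε i + K * m i))
    ≡⟨ sum-cong-≗ (λ i → expand (c i) (x i) (ε i) K (m i)) ⟩
  sum (λ i → c i * x i + c i * ε i + K * (c i * m i))
    ≡⟨ ∑-distrib-+ (λ i → c i * x i + c i * ε i) (λ i → K * (c i * m i)) ⟩
  sum (λ i → c i * x i + c i * ε i) + sum (λ i → K * (c i * m i))
    ≡⟨ cong₂ _+_ (∑-distrib-+ (λ i → c i * x i) (λ i → c i * ε i))
                 (sym (*-distribˡ-sum K (λ i → c i * m i))) ⟩
  sum (λ i → c i * x i) + sum (λ i → c i * ε i) + K * sum (λ i → c i * m i) ∎
  where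
  open ≡-Reasoning
  expand : ∀ c x ε K m → c * (x + ε + K * m) ≡ c * x + c * ε + K * (c * m)
  expand = solve-∀

unit-parity : ∀ {ε} → Unit ε → ∀ c → ∃ λ δ → c * ε ≡ c + + 2 * δ
unit-parity (inj₁ refl) c = 0ℤ , solve (c ∷ [])
unit-parity (inj₂ refl) c = - c , solve (c ∷ [])

∣*unit∣ : ∀ {ε} → Unit ε → ∀ c → ∣ c * ε ∣ ≡ ∣ c ∣
∣*unit∣ (inj₁ refl) c = trans (abs-* c 1ℤ) (ℕ.*-identityʳ ∣ c ∣)
∣*unit∣ (inj₂ refl) c = trans (abs-* c -1ℤ) (ℕ.*-identityʳ ∣ c ∣)

odd-sum-*-units : ∀ {n} (c ε : Fin n → ℤ) → (∀ i → Unit (ε i)) → Oddℤ (sum c) →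
                  Oddℤ (sum (λ i → c i * ε i))
odd-sum-*-units c ε units (u , odd) = u + sum δ , (begin
  sum (λ i → c i * ε i)         ≡⟨ sum-cong-≗ (λ i → proj₂ (unit-parity (units i) (c i))) ⟩
  sum (λ i → c i + + 2 * δ i)   ≡⟨ ∑-distrib-+ c (λ i → + 2 * δ i) ⟩
  sum c + sum (λ i → + 2 * δ i) ≡⟨ cong₂ _+_ odd (sym (*-distribˡ-sum (+ 2) δ)) ⟩
  + 1 + + 2 * u + + 2 * sum δ   ≡⟨ +-assoc (+ 1) (+ 2 * u) (+ 2 * sum δ) ⟩
  + 1 + (+ 2 * u + + 2 * sum δ) ≡⟨ cong (λ s → + 1 + s) (*-distribˡ-+ (+ 2) u (sum δ)) ⟨
  + 1 + + 2 * (u + sum δ)       ∎)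
  where
  open ≡-Reasoning
  δ : Fin _ → ℤ
  δ i = proj₁ (unit-parity (units i) (c i))

Z≤-adjacent-step : ∀ {N n} K (g : Z≤ N n) (x y : Fin n → Fin (ℕ.suc K)) →
                   (∀ j → Adj (ℕ.suc K) (x j) (y j)) →
                   ∃ λ e → Oddℤ e × ∣ e ∣ ℕ.≤ N ×
                     ∃ λ Q → proj₁ g (toℤ ∘ y) ≡ proj₁ g (toℤ ∘ x) + e + + ℕ.suc K * Q
Z≤-adjacent-step K (f , c , Σ∣c∣≤N , odd , f-linear) x y adj =
  e , odd-sum-*-units c ε unit (subst Oddℤ (sumℤ≡sum c) odd) ,
  ℕ.≤-trans (∣sum∣≤sumℕ _ _ (λ i → ℕ.≤-reflexive (∣*unit∣ (unit i) (c i)))) Σ∣c∣≤N ,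
  Q , (begin
    f (toℤ ∘ y)                                 ≡⟨ value (toℤ ∘ y) ⟩
    sum (λ i → c i * toℤ (y i))                 ≡⟨ sum-cong-≗ (λ i → cong (c i *_) (shift i)) ⟩
    sum (λ i → c i * (toℤ (x i) + ε i + k * m i)) ≡⟨ sum-linear-shift c (toℤ ∘ x) ε m k ⟩
    sum (λ i → c i * toℤ (x i)) + e + k * Q     ≡⟨ cong (λ s → s + e + k * Q) (value (toℤ ∘ x)) ⟨
    f (toℤ ∘ x) + e + k * Q                     ∎)
  where
  open ≡-Reasoning
  k : ℤ
  k = + ℕ.suc K
  step : ∀ j → ∃ λ ε → Unit ε × ∃ λ m → toℤ (y j) ≡ toℤ (x j) + ε + k * m
  step j = adjacent-step K (x j) (y j) (adj j)
  ε m : Fin _ → ℤ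
  ε = proj₁ ∘ step
  m = proj₁ ∘ proj₂ ∘ proj₂ ∘ step
  unit : ∀ j → Unit (ε j)
  unit = proj₁ ∘ proj₂ ∘ step
  shift : ∀ j → toℤ (y j) ≡ toℤ (x j) + ε j + k * m j
  shift = proj₂ ∘ proj₂ ∘ proj₂ ∘ step
  e Q : ℤ
  e = sum (λ i → c i * ε i)
  Q = sum (λ i → c i * m i)
  value : ∀ z → f z ≡ sum (λ i → c i * z i)
  value z = trans (f-linear z) (sumℤ≡sum (λ i → c i * z i))

≢⇒Adj₃ : (a b : Fin 3) → a ≢ b → Adj 3 a b
≢⇒Adj₃ 0F 0F a≢b = contradiction refl a≢b
≢⇒Adj₃ 0F 1F _   = inj₁ refl
≢⇒Adj₃ 0F 2F _   = inj₂ refl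
≢⇒Adj₃ 1F 0F _   = inj₂ refl
≢⇒Adj₃ 1F 1F a≢b = contradiction refl a≢b
≢⇒Adj₃ 1F 2F _   = inj₁ refl
≢⇒Adj₃ 2F 0F _   = inj₁ refl
≢⇒Adj₃ 2F 1F _   = inj₂ refl
≢⇒Adj₃ 2F 2F a≢b = contradiction refl a≢b

arcPol : ∀ t {N n} → 3 ℕ.* N ℕ.≤ ℕ.suc (2 ℕ.* t) → Z≤ N n → Pol (ℕ.suc (2 ℕ.* t)) n
arcPol t 3N≤k g = colour , λ x y adj → ≢⇒Adj₃ (colour x) (colour y) (separated x y adj)
  where
  k : ℕ
  k = ℕ.suc (2 ℕ.* t)
  T : ℤ
  T = + ℕ.suc t
  value : (Fin _ → Fin k) → ℤ
  value x = proj₁ g (toℤ ∘ x)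
  colour : (Fin _ → Fin k) → Fin 3
  colour x = arc k (value x * T)
  distribute : ∀ a e k q T → (a + e + k * q) * T ≡ a * T + e * T + k * (q * T)
  distribute = solve-∀
  separated : ∀ x y → (∀ j → Adj k (x j) (y j)) → colour x ≢ colour y
  separated x y adj with Z≤-adjacent-step (2 ℕ.* t) g x y adj
  ... | e , odd , ∣e∣≤N , Q , eq = arc-odd-shift t e (value x * T) (value y * T) (Q * T) odd
    (ℕ.≤-trans (ℕ.*-monoʳ-≤ 3 ∣e∣≤N) 3N≤k)
    (trans (cong (_* T) eq) (distribute (value x) e (+ k) Q T))

lemmaA1 : (k N : ℕ) → OddNat k → OddNat N → 3 ℕ.* N ℕ.≤ k → MinionHom N k
lemmaA1 k N (t , refl) _ 3N≤k = record
  { η       = arcPol t 3N≤k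
  ; η-minor = λ π g h h≗g∘π x → cong (λ v → arc k (v * + ℕ.suc t)) (h≗g∘π (toℤ ∘ x))
  }
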